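{- Let $\mathbf{w}$ be any infinite word over $\{0,1,2,3\}$ that is squarefree and contains no occurrence of any of the subwords $12$, $13$, $21$, $32$, $231$, $10302$. Let $g$ be the morphism defined by $g(0)=010011$, $g(1)=010110$, $g(2)=011001$, $g(3)=011010$. Then the infinite binary word $g(\mathbf{w})$ is cubefree and contains no square $xx$ with $|x|\ge 4$ as a subword.
   Context: A subword is a contiguous block. A square is a nonempty word $xx$, a cube a nonempty word $xxx$; a word is squarefree (resp. cubefree) if it has no square (resp. cube) as a subword. A morphism $g$ satisfies $g(xy)=g(x)g(y)$ and is applied to an infinite word letter by letter, concatenating the images. $|x|$ denotes the length of $x$. -}

module Defs where

open import Data.Nat using (ℕ; zero; suc; _+_; _*_; _<_; _≤_; NonZero)
open import Data.Nat.DivMod using (_/_; _%_; m%n<n)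
open import Data.Fin using (Fin; fromℕ<; zero; suc)
open import Data.Vec using (Vec; lookup; []; _∷_)
open import Data.List using (List; []; _∷_)
open import Data.Product using (∃; _×_)
open import Data.Unit using (⊤)
open import Relation.Binary.PropositionalEquality using (_≡_)
open import Relation.Nullary using (¬_)

InfWord : Set → Set
InfWord A = ℕ → A

OccursAt : {A : Set} → InfWord A → ℕ → List A → Set
OccursAt w i []       = ⊤
OccursAt w i (a ∷ u)  = (w i ≡ a) × OccursAt w (suc i) u

HasSubword : {A : Set} → InfWord A → List A → Set
HasSubword w u = ∃ λ i → OccursAt w i u

SquareAt : {A : Set} → InfWord A → ℕ → ℕ → Set
SquareAt w i p = 1 ≤ p × (∀ j → j < p → w (i + j) ≡ w (i + p + j))

CubeAt : {A : Set} → InfWord A → ℕ → ℕ → Set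
CubeAt w i p = 1 ≤ p × (∀ j → j < p + p → w (i + j) ≡ w (i + p + j))

Squarefree : {A : Set} → InfWord A → Set
Squarefree w = ∀ i p → ¬ SquareAt w i p

Cubefree : {A : Set} → InfWord A → Set
Cubefree w = ∀ i p → ¬ CubeAt w i p

NoSquareOfPeriodAtLeast : {A : Set} → ℕ → InfWord A → Set
NoSquareOfPeriodAtLeast m w = ∀ i p → m ≤ p → ¬ SquareAt w i p

applyUniform : {A B : Set} (k : ℕ) .{{_ : NonZero k}} →
               (A → Vec B k) → InfWord A → InfWord B
applyUniform k g w n = lookup (g (w (n / k))) (fromℕ< (m%n<n n k))

g : Fin 4 → Vec (Fin 2) 6
g zero                   = zero ∷ suc zero ∷ zero ∷ zero ∷ suc zero ∷ suc zero ∷ []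

g (suc zero)             = zero ∷ suc zero ∷ zero ∷ suc zero ∷ suc zero ∷ zero ∷ []
g (suc (suc zero))       = zero ∷ suc zero ∷ suc zero ∷ zero ∷ zero ∷ suc zero ∷ []
g (suc (suc (suc zero))) = zero ∷ suc zero ∷ suc zero ∷ zero ∷ suc zero ∷ zero ∷ []

a0 a1 a2 a3 : Fin 4
a0 = zero
a1 = suc zero
a2 = suc (suc zero)
a3 = suc (suc (suc zero))

-- Write v = g(w); position 6k + t of v is letter t of g(w k), so the 24 letters of v from
-- position 6k on are g(w k … w (k+3)), and this factor of w obeys the constraints of the
-- hypothesis. A finite check over such factors shows that no square of period 4 … 8 and no
-- cube of period ≤ 3 starts in block k, and that every factor of length 9 of v determines its
-- starting position modulo 6. So a square of period p ≥ 9 has p = 6q with q ≥ 2. If it starts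
-- at a block boundary it desubstitutes, g being injective, to a square of period q in w.
-- Otherwise its inner blocks still desubstitute, and the two partial blocks at its ends force,
-- by a second finite check on g, either a square in w or a factor 1X3X2 of w with |X| = q − 1,
-- which squarefreeness and the factors 12, 13, 32, 10302 exclude. Cubes of period ≥ 4 contain
-- squares of period ≥ 4.

module Submission where

open import Defs
open import Data.Empty using (⊥; ⊥-elim)
open import Data.Fin using (Fin; zero; suc; toℕ; fromℕ<)
import Data.Fin as Fin
open import Data.Fin.Properties
  using (all?; fromℕ<-cong; fromℕ<-toℕ; toℕ<n; toℕ-fromℕ<)
  renaming (_≟_ to _≟ᶠ_; _≤?_ to _≤ᶠ?_; _<?_ to _<ᶠ?_)
open import Data.List using (List; []; _∷_; find)
import Data.List.Properties as List
open import Data.List.Membership.Propositional using (_∈_)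
open import Data.List.Membership.DecPropositional (List.≡-dec (_≟ᶠ_ {4})) using (_∉_; _∉?_)
open import Data.List.Relation.Unary.Any using (here; there)
open import Data.Maybe using (maybe)
open import Data.Nat using (ℕ; zero; suc; _+_; _*_; _∸_; _≤_; _<_; z≤n; s≤s; NonZero)
open import Data.Nat.DivMod
  using (_/_; _%_; m≡m%n+[m/n]*n; m%n<n; +-distrib-/-∣ˡ; m*n/n≡m; %-remove-+ˡ;
         m<n⇒m/n≡0; m<n⇒m%n≡m; m<n*o⇒m/o<n)
open import Data.Nat.Divisibility using (_∣_; divides; n∣m*n; ∣m+n∣m⇒∣n)
open import Data.Nat.Properties
  using (≤-trans; <⇒≤; <-≤-trans; ≰⇒>; _≤?_; allUpTo?; n<1+n; n≤1+n; m≤m+n; m≤n+m;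
         m<1+n⇒m<n∨m≡n; m+[n∸m]≡n; +-assoc; +-comm; +-identityʳ; +-cancelˡ-≡; +-cancelˡ-<;
         +-monoʳ-<; +-mono-≤; +-mono-<-≤; *-distribʳ-+; *-monoˡ-≤; *-cancelʳ-<; +-suc;
         +-commutativeSemigroup; module ≤-Reasoning)
  renaming (_≟_ to _≟ℕ_)
open import Algebra.Properties.CommutativeSemigroup +-commutativeSemigroup using (xy∙z≈xz∙y; xy∙z≈zy∙x)
open import Data.List.Membership.DecPropositional _≟ℕ_ using () renaming (_∈?_ to _∈ℕ?_)
open import Data.Product using (_×_; _,_; proj₁; map₂)
import Data.Product.Properties as Product
open import Data.Sum using (_⊎_; inj₁; inj₂; [_,_])
open import Data.Unit using (tt)
open import Data.Vec using (Vec; lookup; tabulate)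
import Data.Vec.Properties as Vec
open import Relation.Nullary using (¬_; Dec; yes; no; ¬?)
open import Relation.Nullary.Decidable using (map′; _×-dec_; _⊎-dec_; _→-dec_; from-yes)
open import Relation.Binary.PropositionalEquality
  using (_≡_; _≢_; refl; sym; trans; cong; cong₂; subst; subst₂; module ≡-Reasoning)

private variable
  A : Set

shift : ℕ → InfWord A → InfWord A
shift k w j = w (k + j)

Periodic : InfWord A → ℕ → ℕ → ℕ → Set
Periodic w i p n = ∀ j → j < n → w (i + j) ≡ w (i + p + j)

periodic-transfer : ∀ {u u' : InfWord A} {i i' p n} →
  (∀ j → j < p + n → u (i + j) ≡ u' (i' + j)) → Periodic u i p n → Periodic u' i' p n
periodic-transfer {u = u} {u'} {i} {i'} {p} {n} agree per j j<n = begin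
  u' (i' + j)       ≡⟨ agree j (≤-trans j<n (m≤n+m n p)) ⟨
  u (i + j)         ≡⟨ per j j<n ⟩
  u (i + p + j)     ≡⟨ cong u (+-assoc i p j) ⟩
  u (i + (p + j))   ≡⟨ agree (p + j) (+-monoʳ-< p j<n) ⟩
  u' (i' + (p + j)) ≡⟨ cong u' (+-assoc i' p j) ⟨
  u' (i' + p + j)   ∎
  where open ≡-Reasoning

square-transfer : ∀ {u u' : InfWord A} {i i' p} →
  (∀ j → j < p + p → u (i + j) ≡ u' (i' + j)) → SquareAt u i p → SquareAt u' i' p
square-transfer {u = u} {u'} agree = map₂ (periodic-transfer {u = u} {u'} agree)

cube-transfer : ∀ {u u' : InfWord A} {i i' p} →
  (∀ j → j < p + (p + p) → u (i + j) ≡ u' (i' + j)) → CubeAt u i p → CubeAt u' i' p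
cube-transfer {u = u} {u'} agree = map₂ (periodic-transfer {u = u} {u'} agree)

cube⇒square : ∀ {u : InfWord A} {i p} → CubeAt u i p → SquareAt u i p
cube⇒square {p = p} = map₂ (λ per j j<p → per j (≤-trans j<p (m≤m+n p p)))

periodic-at : ∀ {u : InfWord A} {i p n} → Periodic u i p n →
  ∀ m → i ≤ m → m < i + n → u m ≡ u (m + p)
periodic-at {u = u} {i} {p} {n} per m i≤m m<i+n = begin
  u m                 ≡⟨ cong u (m+[n∸m]≡n i≤m) ⟨
  u (i + (m ∸ i))     ≡⟨ per (m ∸ i) (+-cancelˡ-< i _ _ (subst (_< i + n) (sym (m+[n∸m]≡n i≤m)) m<i+n)) ⟩
  u (i + p + (m ∸ i)) ≡⟨ cong u (xy∙z≈xz∙y i p (m ∸ i)) ⟩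
  u (i + (m ∸ i) + p) ≡⟨ cong (λ n → u (n + p)) (m+[n∸m]≡n i≤m) ⟩
  u (m + p)           ∎
  where open ≡-Reasoning

square-of-copies : ∀ {u : InfWord A} i p → 1 ≤ p →
  (∀ m → i ≤ m → m < i + p → u m ≡ u (m + p)) → SquareAt u i p
square-of-copies {u = u} i p 1≤p copy = 1≤p , λ j j<p →
  trans (copy (i + j) (m≤m+n i j) (+-monoʳ-< i j<p)) (cong u (xy∙z≈xz∙y i j p))

square-of-offsets : ∀ {u : InfWord A} i p → 1 ≤ p →
  (∀ j → j < p → u (j + i) ≡ u (j + p + i)) → SquareAt u i p
square-of-offsets {u = u} i p 1≤p per = 1≤p , λ j j<p →
  subst₂ (λ a b → u a ≡ u b) (+-comm j i) (xy∙z≈zy∙x j p i) (per j j<p)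

squarefree-shift : ∀ {w : InfWord A} k → Squarefree w → Squarefree (shift k w)
squarefree-shift {w = w} k sf i p sq =
  sf (k + i) p (square-transfer {u = shift k w} {w} (λ j _ → cong w (sym (+-assoc k i j))) sq)

occursAt-shift : ∀ {w : InfWord A} k i f → OccursAt (shift k w) i f → OccursAt w (k + i) f
occursAt-shift k i []      tt        = tt
occursAt-shift {w = w} k i (a ∷ f) (e , occ) =
  e , subst (λ n → OccursAt w n f) (+-suc k i) (occursAt-shift k (suc i) f occ)

block-bound : ∀ {K m q t} → t < K → m < q → m * K + t < q * K
block-bound {K} {m} {q} {t} t<K m<q = begin-strict
  m * K + t <⟨ +-monoʳ-< (m * K) t<K ⟩
  m * K + K ≡⟨ +-comm (m * K) K ⟩
  suc m * K ≤⟨ *-monoˡ-≤ K m<q ⟩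
  q * K     ∎
  where open ≤-Reasoning

module _ {B : Set} (K : ℕ) .{{_ : NonZero K}} (h : A → Vec B K) where

  image-shift : ∀ w k n → applyUniform K h (shift k w) n ≡ applyUniform K h w (k * K + n)
  image-shift w k n = cong₂ (λ a b → lookup (h (w a)) b)
    (sym (trans (+-distrib-/-∣ˡ n (n∣m*n k)) (cong (_+ n / K) (m*n/n≡m k K))))
    (fromℕ<-cong _ _ (sym (%-remove-+ˡ n (n∣m*n k))) _ _)

  image-block : ∀ w m (t : Fin K) → applyUniform K h w (m * K + toℕ t) ≡ lookup (h (w m)) t
  image-block w m t = begin
    applyUniform K h w (m * K + toℕ t)   ≡⟨ image-shift w m (toℕ t) ⟨
    applyUniform K h (shift m w) (toℕ t) ≡⟨ cong₂ (λ a b → lookup (h (w a)) b)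
      (trans (cong (m +_) (m<n⇒m/n≡0 (toℕ<n t))) (+-identityʳ m))
      (trans (fromℕ<-cong _ _ (m<n⇒m%n≡m (toℕ<n t)) _ (toℕ<n t)) (fromℕ<-toℕ t _)) ⟩
    lookup (h (w m)) t                   ∎
    where open ≡-Reasoning

  image-cong : ∀ {w w'} m → (∀ j → j < m → w j ≡ w' j) →
    ∀ n → n < m * K → applyUniform K h w n ≡ applyUniform K h w' n
  image-cong m agree n n<mK = cong (λ a → lookup (h a) _) (agree (n / K) (m<n*o⇒m/o<n n<mK))

  image-letter-copy : ∀ w m q (t : Fin K) →
    applyUniform K h w (m * K + toℕ t) ≡ applyUniform K h w (m * K + toℕ t + q * K) →
    lookup (h (w m)) t ≡ lookup (h (w (m + q))) t
  image-letter-copy w m q t e = begin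
    lookup (h (w m)) t                         ≡⟨ image-block w m t ⟨
    applyUniform K h w (m * K + toℕ t)         ≡⟨ e ⟩
    applyUniform K h w (m * K + toℕ t + q * K) ≡⟨ cong (applyUniform K h w) (xy∙z≈xz∙y (m * K) (toℕ t) (q * K)) ⟩
    applyUniform K h w (m * K + q * K + toℕ t) ≡⟨ cong (λ n → applyUniform K h w (n + toℕ t)) (*-distribʳ-+ K m q) ⟨
    applyUniform K h w ((m + q) * K + toℕ t)   ≡⟨ image-block w (m + q) t ⟩
    lookup (h (w (m + q))) t                   ∎
    where open ≡-Reasoning

  image-block-copy : ∀ w m q →
    (∀ t → applyUniform K h w (m * K + toℕ t) ≡ applyUniform K h w (m * K + toℕ t + q * K)) →
    h (w m) ≡ h (w (m + q))
  image-block-copy w m q e = begin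
    h (w m)                           ≡⟨ Vec.tabulate∘lookup (h (w m)) ⟨
    tabulate (lookup (h (w m)))       ≡⟨ Vec.tabulate-cong (λ t → image-letter-copy w m q t (e t)) ⟩
    tabulate (lookup (h (w (m + q)))) ≡⟨ Vec.tabulate∘lookup (h (w (m + q))) ⟩
    h (w (m + q))                     ∎
    where open ≡-Reasoning

-- Finite facts about g

all<? : {P : ℕ → Set} → (∀ n → Dec (P n)) → ∀ n → Dec (∀ j → j < n → P j)
all<? P? n = map′ (λ h j j<n → h j<n) (λ h {j} j<n → h j j<n) (allUpTo? P? n)

periodic? : ∀ (u : InfWord (Fin 2)) i p n → Dec (Periodic u i p n)
periodic? u i p = all<? (λ j → u (i + j) ≟ᶠ u (i + p + j))

square? : ∀ (u : InfWord (Fin 2)) i p → Dec (SquareAt u i p)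
square? u i p = 1 ≤? p ×-dec periodic? u i p p

cube? : ∀ (u : InfWord (Fin 2)) i p → Dec (CubeAt u i p)
cube? u i p = 1 ≤? p ×-dec periodic? u i p (p + p)

g-injective : ∀ {x y} → g x ≡ g y → x ≡ y
g-injective {x} {y} = from-yes (all? λ x → all? λ y → Vec.≡-dec _≟ᶠ_ (g x) (g y) →-dec x ≟ᶠ y) x y

-- x, y, z are the blocks at the start, middle and end of a square of period 6q that starts
-- at offset r inside x.
g-overlap : ∀ (r : Fin 6) x y z →
  (∀ t → r Fin.≤ t → lookup (g x) t ≡ lookup (g y) t) →
  (∀ t → t Fin.< r → lookup (g y) t ≡ lookup (g z) t) →
  x ≡ y ⊎ y ≡ z ⊎ (x ≡ a1 × y ≡ a3 × z ≡ a2)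
g-overlap = from-yes (all? {n = 6} λ r → all? λ x → all? λ y → all? λ z →
  all? (λ t → r ≤ᶠ? t →-dec lookup (g x) t ≟ᶠ lookup (g y) t) →-dec
  all? (λ t → t <ᶠ? r →-dec lookup (g y) t ≟ᶠ lookup (g z) t) →-dec
  (x ≟ᶠ y ⊎-dec y ≟ᶠ z ⊎-dec (x ≟ᶠ a1 ×-dec y ≟ᶠ a3 ×-dec z ≟ᶠ a2)))

forbidden : List (List (Fin 4))
forbidden = (a1 ∷ a2 ∷ []) ∷ (a1 ∷ a3 ∷ []) ∷ (a2 ∷ a1 ∷ []) ∷ (a3 ∷ a2 ∷ []) ∷
            (a2 ∷ a3 ∷ a1 ∷ []) ∷ (a1 ∷ a0 ∷ a3 ∷ a0 ∷ a2 ∷ []) ∷ []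

Admissible : Fin 4 → Fin 4 → Fin 4 → Fin 4 → Set
Admissible a b c d = a ≢ b × b ≢ c × c ≢ d × (a , b) ≢ (c , d)
  × (a ∷ b ∷ []) ∉ forbidden × (b ∷ c ∷ []) ∉ forbidden × (c ∷ d ∷ []) ∉ forbidden
  × (a ∷ b ∷ c ∷ []) ∉ forbidden × (b ∷ c ∷ d ∷ []) ∉ forbidden

admissible? : ∀ a b c d → Dec (Admissible a b c d)
admissible? a b c d = ¬? (a ≟ᶠ b) ×-dec ¬? (b ≟ᶠ c) ×-dec ¬? (c ≟ᶠ d)
  ×-dec ¬? (Product.≡-dec _≟ᶠ_ _≟ᶠ_ (a , b) (c , d))
  ×-dec (a ∷ b ∷ []) ∉? forbidden ×-dec (b ∷ c ∷ []) ∉? forbidden ×-dec (c ∷ d ∷ []) ∉? forbidden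
  ×-dec (a ∷ b ∷ c ∷ []) ∉? forbidden ×-dec (b ∷ c ∷ d ∷ []) ∉? forbidden

-- Only positions 0 … 3 matter; the last letter is repeated beyond them.
fourLetters : Fin 4 → Fin 4 → Fin 4 → Fin 4 → InfWord (Fin 4)
fourLetters a b c d 0 = a
fourLetters a b c d 1 = b
fourLetters a b c d 2 = c
fourLetters a b c d _ = d

window : Fin 4 → Fin 4 → Fin 4 → Fin 4 → InfWord (Fin 2)
window a b c d = applyUniform 6 g (fourLetters a b c d)

code : ℕ → InfWord (Fin 2) → ℕ
code zero    u = 0
code (suc n) u = toℕ (u 0) + 2 * code n (shift 1 u)

-- For each r < 6, the codes of the factors of length 9 starting at position r of the windows
-- (see window-phase); any other code gets the junk phase 0.
phaseTable : List (ℕ × List ℕ)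
phaseTable =
  (0 , 150 ∷ 154 ∷ 166 ∷ 178 ∷ 422 ∷ 434 ∷ []) ∷
  (1 , 75 ∷ 77 ∷ 83 ∷ 211 ∷ 217 ∷ 331 ∷ 345 ∷ []) ∷
  (2 , 108 ∷ 293 ∷ 294 ∷ 297 ∷ 361 ∷ 364 ∷ 421 ∷ 428 ∷ []) ∷
  (3 , 180 ∷ 182 ∷ 210 ∷ 214 ∷ 310 ∷ 402 ∷ 403 ∷ 404 ∷ []) ∷
  (4 , 90 ∷ 91 ∷ 105 ∷ 107 ∷ 155 ∷ 201 ∷ 202 ∷ []) ∷
  (5 , 301 ∷ 308 ∷ 309 ∷ 333 ∷ 356 ∷ 357 ∷ []) ∷ []

phaseOfCode : ℕ → ℕ
phaseOfCode n = maybe proj₁ 0 (find (λ (_ , codes) → n ∈ℕ? codes) phaseTable)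

phase : InfWord (Fin 2) → ℕ
phase u = phaseOfCode (code 9 u)

window-short-squares : ∀ a b c d → Admissible a b c d →
  ∀ r → r < 6 → ∀ p → p < 9 → 4 ≤ p → ¬ SquareAt (window a b c d) r p
window-short-squares = from-yes (all? λ a → all? λ b → all? λ c → all? λ d → admissible? a b c d →-dec
  all<? (λ r → all<? (λ p → 4 ≤? p →-dec ¬? (square? (window a b c d) r p)) 9) 6)

window-short-cubes : ∀ a b c d → Admissible a b c d →
  ∀ r → r < 6 → ∀ p → p < 4 → ¬ CubeAt (window a b c d) r p
window-short-cubes = from-yes (all? λ a → all? λ b → all? λ c → all? λ d → admissible? a b c d →-dec
  all<? (λ r → all<? (λ p → ¬? (cube? (window a b c d) r p)) 4) 6)

window-phase : ∀ a b c d → Admissible a b c d → ∀ r → r < 6 → phase (shift r (window a b c d)) ≡ r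
window-phase = from-yes (all? λ a → all? λ b → all? λ c → all? λ d → admissible? a b c d →-dec
  all<? (λ r → phase (shift r (window a b c d)) ≟ℕ r) 6)

code-cong : ∀ n {u u' : InfWord (Fin 2)} → (∀ j → j < n → u j ≡ u' j) → code n u ≡ code n u'
code-cong zero    agree = refl
code-cong (suc n) agree = cong₂ (λ a b → toℕ a + 2 * b) (agree 0 (s≤s z≤n))
  (code-cong n (λ j j<n → agree (suc j) (s≤s j<n)))

phase-cong : ∀ {u u' : InfWord (Fin 2)} → (∀ j → j < 9 → u j ≡ u' j) → phase u ≡ phase u'
phase-cong agree = cong phaseOfCode (code-cong 9 agree)

record Constrained (w : InfWord (Fin 4)) : Set where
  field
    squarefree : Squarefree w
    no-12      : ¬ HasSubword w (a1 ∷ a2 ∷ [])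
    no-13      : ¬ HasSubword w (a1 ∷ a3 ∷ [])
    no-21      : ¬ HasSubword w (a2 ∷ a1 ∷ [])
    no-32      : ¬ HasSubword w (a3 ∷ a2 ∷ [])
    no-231     : ¬ HasSubword w (a2 ∷ a3 ∷ a1 ∷ [])
    no-10302   : ¬ HasSubword w (a1 ∷ a0 ∷ a3 ∷ a0 ∷ a2 ∷ [])

constrained-shift : ∀ {w} k → Constrained w → Constrained (shift k w)
constrained-shift {w} k c = record
  { squarefree = squarefree-shift {w = w} k squarefree
  ; no-12      = avoid no-12
  ; no-13      = avoid no-13
  ; no-21      = avoid no-21
  ; no-32      = avoid no-32
  ; no-231     = avoid no-231
  ; no-10302   = avoid no-10302
  }
  where
  open Constrained c
  avoid : ∀ {f} → ¬ HasSubword w f → ¬ HasSubword (shift k w) f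
  avoid ¬occ (i , occ) = ¬occ (k + i , occursAt-shift k i _ occ)

module _ {u : InfWord (Fin 4)} (c : Constrained u) where
  open Constrained c

  no-square₁ : ∀ i → u i ≢ u (1 + i)
  no-square₁ i e = squarefree i 1 (square-of-offsets {u = u} i 1 (s≤s z≤n) λ
    { zero _ → e ; (suc j) (s≤s ()) })

  no-square₂ : ∀ i → u i ≡ u (2 + i) → u (1 + i) ≢ u (3 + i)
  no-square₂ i e₀ e₁ = squarefree i 2 (square-of-offsets {u = u} i 2 (s≤s z≤n) λ
    { zero _ → e₀ ; (suc zero) _ → e₁ ; (suc (suc j)) (s≤s (s≤s ())) })

  forbidden-absent : ∀ {f} i → f ∈ forbidden → ¬ OccursAt u i f
  forbidden-absent i (here refl)                                         occ = no-12 (i , occ)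
  forbidden-absent i (there (here refl))                                 occ = no-13 (i , occ)
  forbidden-absent i (there (there (here refl)))                         occ = no-21 (i , occ)
  forbidden-absent i (there (there (there (here refl))))                 occ = no-32 (i , occ)
  forbidden-absent i (there (there (there (there (here refl)))))         occ = no-231 (i , occ)
  forbidden-absent i (there (there (there (there (there (here refl)))))) occ = no-10302 (i , occ)

  admissible-prefix : Admissible (u 0) (u 1) (u 2) (u 3)
  admissible-prefix = no-square₁ 0 , no-square₁ 1 , no-square₁ 2
    , (λ e → no-square₂ 0 (Product.,-injectiveˡ e) (Product.,-injectiveʳ e))
    , (λ f∈ → forbidden-absent 0 f∈ (refl , refl , tt))
    , (λ f∈ → forbidden-absent 1 f∈ (refl , refl , tt))
    , (λ f∈ → forbidden-absent 2 f∈ (refl , refl , tt))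
    , (λ f∈ → forbidden-absent 0 f∈ (refl , refl , refl , tt))
    , (λ f∈ → forbidden-absent 1 f∈ (refl , refl , refl , tt))

  after-1-comes-0 : ∀ i → u i ≡ a1 → u (1 + i) ≡ a0
  after-1-comes-0 i ui≡1 with u (1 + i) in eq
  ... | zero                 = refl
  ... | suc zero             = ⊥-elim (no-square₁ i (trans ui≡1 (sym eq)))
  ... | suc (suc zero)       = ⊥-elim (no-12 (i , ui≡1 , eq , tt))
  ... | suc (suc (suc zero)) = ⊥-elim (no-13 (i , ui≡1 , eq , tt))

  before-2-comes-0 : ∀ i → u (1 + i) ≡ a2 → u i ≡ a0
  before-2-comes-0 i ui+1≡2 with u i in eq
  ... | zero                 = refl
  ... | suc zero             = ⊥-elim (no-12 (i , eq , ui+1≡2 , tt))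
  ... | suc (suc zero)       = ⊥-elim (no-square₁ i (trans eq (sym ui+1≡2)))
  ... | suc (suc (suc zero)) = ⊥-elim (no-32 (i , eq , ui+1≡2 , tt))

  -- X = u 1 … u (q − 1) begins and ends with 0; its second and its second-to-last letter
  -- are then forced into a square or into 10302.
  no-1X3X2 : ∀ q → 2 ≤ q → u 0 ≡ a1 → u q ≡ a3 → u (q + q) ≡ a2 →
             (∀ m → 1 ≤ m → m < q → u m ≡ u (m + q)) → ⊥
  no-1X3X2 (suc zero) (s≤s ())
  no-1X3X2 (suc (suc zero)) _ u₀ u₂ u₄ copy =
    no-10302 (0 , u₀ , u₁ , u₂ , trans (sym (copy 1 (s≤s z≤n) (s≤s (s≤s z≤n)))) u₁ , u₄ , tt)
    where
    u₁ : u 1 ≡ a0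
    u₁ = after-1-comes-0 0 u₀
  no-1X3X2 q@(suc (suc (suc k))) _ u₀ u-q u-2q copy = by-second (u 2) refl
    where
    first : u 1 ≡ a0
    first = after-1-comes-0 0 u₀
    copy-first : u (1 + q) ≡ a0
    copy-first = trans (sym (copy 1 (s≤s z≤n) (s≤s (s≤s z≤n)))) first
    copy-second : u 2 ≡ u (2 + q)
    copy-second = copy 2 (s≤s z≤n) (s≤s (s≤s (s≤s z≤n)))
    copy-last : u (2 + k) ≡ u (2 + k + q)
    copy-last = copy (2 + k) (s≤s z≤n) (n<1+n (2 + k))
    last : u (2 + k) ≡ a0
    last = trans copy-last (before-2-comes-0 (2 + k + q) u-2q)

    by-second-to-last : ∀ x → u (1 + k) ≡ x → u 2 ≡ a2 → ⊥
    by-second-to-last zero                   x _ = no-square₁ (1 + k) (trans x (sym last))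
    by-second-to-last (suc zero)             x y =
      no-10302 (1 + k , x , last , u-q , copy-first , trans (sym copy-second) y , tt)
    by-second-to-last (suc (suc zero))       x _ = no-square₂ (k + q)
        (trans (before-2-comes-0 (k + q) copy-x) (sym (trans (sym copy-last) last)))
        (trans copy-x (sym u-2q))
      where
      copy-x : u (1 + k + q) ≡ a2
      copy-x = trans (sym (copy (1 + k) (s≤s z≤n) (s≤s (s≤s (n≤1+n k))))) x
    by-second-to-last (suc (suc (suc zero))) x _ =
      no-square₂ (1 + k) (trans x (sym u-q)) (trans last (sym copy-first))

    by-second : ∀ y → u 2 ≡ y → ⊥
    by-second zero                   y = no-square₁ 1 (trans first (sym y))
    by-second (suc zero)             y =
      no-square₂ 0 (trans u₀ (sym y)) (trans first (sym (after-1-comes-0 2 y)))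
    by-second (suc (suc zero))       y = by-second-to-last (u (1 + k)) refl y
    by-second (suc (suc (suc zero))) y =
      no-square₂ (2 + k) (trans last (sym copy-first)) (trans u-q (sym (trans (sym copy-second) y)))

within-window : ∀ {r j} m → r < 6 → j < m → m ≤ 18 → r + j < 24
within-window m r<6 j<m m≤18 = +-mono-<-≤ r<6 (≤-trans (<⇒≤ j<m) m≤18)

module _ {u : InfWord (Fin 4)} (c : Constrained u) where
  open Constrained c

  private
    v : InfWord (Fin 2)
    v = applyUniform 6 g u
    W : InfWord (Fin 2)
    W = window (u 0) (u 1) (u 2) (u 3)

  image-window : ∀ n → n < 24 → v n ≡ W n
  image-window = image-cong 6 g 4 prefix
    where
    prefix : ∀ j → j < 4 → u j ≡ fourLetters (u 0) (u 1) (u 2) (u 3) j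
    prefix 0 _ = refl
    prefix 1 _ = refl
    prefix 2 _ = refl
    prefix 3 _ = refl
    prefix (suc (suc (suc (suc j)))) (s≤s (s≤s (s≤s (s≤s ()))))

  private
    image-agrees-window : ∀ r m → r < 6 → m ≤ 18 → ∀ j → j < m → v (r + j) ≡ W (r + j)
    image-agrees-window r m r<6 m≤18 j j<m = image-window (r + j) (within-window m r<6 j<m m≤18)

  short-square : ∀ r p → r < 6 → 4 ≤ p → p ≤ 8 → ¬ SquareAt v r p
  short-square r p r<6 4≤p p≤8 sq =
    window-short-squares _ _ _ _ (admissible-prefix c) r r<6 p (s≤s p≤8) 4≤p
      (square-transfer {u = v} {W} {r} {r}
        (image-agrees-window r (p + p) r<6 (≤-trans (+-mono-≤ p≤8 p≤8) (m≤m+n 16 2))) sq)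

  short-cube : ∀ r p → r < 6 → p ≤ 3 → ¬ CubeAt v r p
  short-cube r p r<6 p≤3 cube =
    window-short-cubes _ _ _ _ (admissible-prefix c) r r<6 p (s≤s p≤3)
      (cube-transfer {u = v} {W} {r} {r}
        (image-agrees-window r (p + (p + p)) r<6
          (≤-trans (+-mono-≤ p≤3 (+-mono-≤ p≤3 p≤3)) (m≤m+n 9 9))) cube)

  image-phase : ∀ r → r < 6 → phase (shift r v) ≡ r
  image-phase r r<6 = trans (phase-cong (image-agrees-window r 9 r<6 (m≤m+n 9 9)))
    (window-phase _ _ _ _ (admissible-prefix c) r r<6)

  module _ {r q} (r<6 : r < 6) (2≤q : 2 ≤ q) (per : Periodic v r (q * 6) (q * 6)) where

    copy-letter : ∀ m t → r ≤ m * 6 + toℕ t → m * 6 + toℕ t < r + q * 6 →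
                  lookup (g (u m)) t ≡ lookup (g (u (m + q))) t
    copy-letter m t r≤n n<r+p = image-letter-copy 6 g u m q t (periodic-at {u = v} per _ r≤n n<r+p)

    copy-block : ∀ m → r ≤ m * 6 → m < q → u m ≡ u (m + q)
    copy-block m r≤6m m<q = g-injective (image-block-copy 6 g u m q λ t →
      periodic-at {u = v} per _ (≤-trans r≤6m (m≤m+n _ _)) (≤-trans (block-bound (toℕ<n t) m<q) (m≤n+m _ r)))

    copy-inner-block : ∀ m → 1 ≤ m → m < q → u m ≡ u (m + q)
    copy-inner-block m 1≤m = copy-block m (≤-trans (<⇒≤ r<6) (*-monoˡ-≤ 6 1≤m))

    copy-first-block-tail : ∀ t → fromℕ< r<6 Fin.≤ t → lookup (g (u 0)) t ≡ lookup (g (u q)) t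
    copy-first-block-tail t r≤t = copy-letter 0 t (subst (_≤ toℕ t) (toℕ-fromℕ< r<6) r≤t)
      (<-≤-trans (toℕ<n t) (≤-trans (*-monoˡ-≤ 6 (<⇒≤ 2≤q)) (m≤n+m _ r)))

    copy-last-block-head : ∀ t → t Fin.< fromℕ< r<6 → lookup (g (u q)) t ≡ lookup (g (u (q + q))) t
    copy-last-block-head t t<r = copy-letter q t
      (≤-trans (<⇒≤ r<6) (≤-trans (*-monoˡ-≤ 6 (<⇒≤ 2≤q)) (m≤m+n _ _)))
      (subst (q * 6 + toℕ t <_) (+-comm (q * 6) r)
        (+-monoʳ-< (q * 6) (subst (toℕ t <_) (toℕ-fromℕ< r<6) t<r)))

  no-block-square : ∀ r q → r < 6 → 2 ≤ q → ¬ SquareAt v r (q * 6)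
  no-block-square zero q r<6 2≤q (_ , per) =
    squarefree 0 q (square-of-copies 0 q (<⇒≤ 2≤q) λ m _ → copy-block r<6 2≤q per m z≤n)
  no-block-square r@(suc _) q r<6 2≤q (_ , per) =
    by-overlap (g-overlap (fromℕ< r<6) (u 0) (u q) (u (q + q))
      (copy-first-block-tail r<6 2≤q per) (copy-last-block-head r<6 2≤q per))
    where
    by-overlap : u 0 ≡ u q ⊎ u q ≡ u (q + q) ⊎ (u 0 ≡ a1 × u q ≡ a3 × u (q + q) ≡ a2) → ⊥
    by-overlap (inj₁ x≡y) = squarefree 0 q (square-of-copies 0 q (<⇒≤ 2≤q) λ
      { zero _ _ → x≡y ; m@(suc _) _ m<q → copy-inner-block r<6 2≤q per m (s≤s z≤n) m<q })
    by-overlap (inj₂ (inj₁ y≡z)) = squarefree 1 q (square-of-copies 1 q (<⇒≤ 2≤q) λ m 1≤m m<1+q →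
      [ copy-inner-block r<6 2≤q per m 1≤m , (λ m≡q → subst (λ m → u m ≡ u (m + q)) (sym m≡q) y≡z) ]
        (m<1+n⇒m<n∨m≡n m<1+q))
    by-overlap (inj₂ (inj₂ (x≡1 , y≡3 , z≡2))) =
      no-1X3X2 c q 2≤q x≡1 y≡3 z≡2 (copy-inner-block r<6 2≤q per)

-- Squares and cubes in g(w)

m%n≡[m+o]%n⇒n∣o : ∀ m o n .{{_ : NonZero n}} → m % n ≡ (m + o) % n → n ∣ o
m%n≡[m+o]%n⇒n∣o m o n eq =
  ∣m+n∣m⇒∣n (subst (n ∣_) quotients (n∣m*n ((m + o) / n))) (n∣m*n (m / n))
  where
  open ≡-Reasoning
  quotients : (m + o) / n * n ≡ m / n * n + o
  quotients = +-cancelˡ-≡ (m % n) _ _ (begin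
    m % n + (m + o) / n * n       ≡⟨ cong (_+ (m + o) / n * n) eq ⟩
    (m + o) % n + (m + o) / n * n ≡⟨ m≡m%n+[m/n]*n (m + o) n ⟨
    m + o                         ≡⟨ cong (_+ o) (m≡m%n+[m/n]*n m n) ⟩
    m % n + m / n * n + o         ≡⟨ +-assoc (m % n) _ o ⟩
    m % n + (m / n * n + o)       ∎)

module _ {w : InfWord (Fin 4)} (c : Constrained w) where

  private
    v : InfWord (Fin 2)
    v = applyUniform 6 g w
    suffix-image : ℕ → InfWord (Fin 2)
    suffix-image i = applyUniform 6 g (shift (i / 6) w)

  local-view : ∀ i j → v (i + j) ≡ suffix-image i (i % 6 + j)
  local-view i j = begin
    v (i + j)                   ≡⟨ cong (λ n → v (n + j)) (trans (m≡m%n+[m/n]*n i 6) (+-comm (i % 6) _)) ⟩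
    v (i / 6 * 6 + i % 6 + j)   ≡⟨ cong v (+-assoc (i / 6 * 6) (i % 6) j) ⟩
    v (i / 6 * 6 + (i % 6 + j)) ≡⟨ image-shift 6 g w (i / 6) (i % 6 + j) ⟨
    suffix-image i (i % 6 + j)  ∎
    where open ≡-Reasoning

  local-square : ∀ i p → SquareAt v i p → SquareAt (suffix-image i) (i % 6) p
  local-square i p = square-transfer {u = v} {suffix-image i} {i} {i % 6} (λ j _ → local-view i j)

  local-cube : ∀ i p → CubeAt v i p → CubeAt (suffix-image i) (i % 6) p
  local-cube i p = cube-transfer {u = v} {suffix-image i} {i} {i % 6} (λ j _ → local-view i j)

  phase-at : ∀ i → phase (shift i v) ≡ i % 6
  phase-at i = trans (phase-cong {shift i v} {shift (i % 6) (suffix-image i)} (λ j _ → local-view i j))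
    (image-phase (constrained-shift (i / 6) c) (i % 6) (m%n<n i 6))

  long-period-divisible : ∀ i p → 9 ≤ p → SquareAt v i p → 6 ∣ p
  long-period-divisible i p 9≤p (_ , per) = m%n≡[m+o]%n⇒n∣o i p 6 (begin
    i % 6                   ≡⟨ phase-at i ⟨
    phase (shift i v)       ≡⟨ phase-cong {shift i v} {shift (i + p) v} (λ j j<9 → per j (≤-trans j<9 9≤p)) ⟩
    phase (shift (i + p) v) ≡⟨ phase-at (i + p) ⟩
    (i + p) % 6             ∎)
    where open ≡-Reasoning

  image-long-squarefree : NoSquareOfPeriodAtLeast 4 v
  image-long-squarefree i p 4≤p sq with p ≤? 8
  ... | yes p≤8 = short-square (constrained-shift (i / 6) c) (i % 6) p (m%n<n i 6) 4≤p p≤8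
                    (local-square i p sq)
  ... | no p≰8  = by-period (long-period-divisible i p (≰⇒> p≰8) sq)
    where
    by-period : 6 ∣ p → ⊥
    by-period (divides q p≡q*6) = no-block-square (constrained-shift (i / 6) c) (i % 6) q (m%n<n i 6) 2≤q
      (subst (SquareAt (suffix-image i) (i % 6)) p≡q*6 (local-square i p sq))
      where
      2≤q : 2 ≤ q
      2≤q = *-cancelʳ-< 6 1 q (≤-trans (m≤m+n 7 2) (subst (9 ≤_) p≡q*6 (≰⇒> p≰8)))

  image-cubefree : Cubefree v
  image-cubefree i p cube with p ≤? 3
  ... | yes p≤3 = short-cube (constrained-shift (i / 6) c) (i % 6) p (m%n<n i 6) p≤3 (local-cube i p cube)
  ... | no p≰3  = image-long-squarefree i p (≰⇒> p≰3) (cube⇒square {u = v} {i} cube)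

theorem3 : (w : InfWord (Fin 4)) →
    Squarefree w →
    ¬ HasSubword w (a1 ∷ a2 ∷ []) →
    ¬ HasSubword w (a1 ∷ a3 ∷ []) →
    ¬ HasSubword w (a2 ∷ a1 ∷ []) →
    ¬ HasSubword w (a3 ∷ a2 ∷ []) →
    ¬ HasSubword w (a2 ∷ a3 ∷ a1 ∷ []) →
    ¬ HasSubword w (a1 ∷ a0 ∷ a3 ∷ a0 ∷ a2 ∷ []) →
    Cubefree (applyUniform 6 g w) × NoSquareOfPeriodAtLeast 4 (applyUniform 6 g w)
theorem3 w sf h12 h13 h21 h32 h231 h10302 = image-cubefree c , image-long-squarefree c
  where
  c : Constrained w
  c = record { squarefree = sf ; no-12 = h12 ; no-13 = h13 ; no-21 = h21 ; no-32 = h32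
             ; no-231 = h231 ; no-10302 = h10302 }
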